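{- Let $A$ be a pseudo-BCI algebra. (1) If $d$ is a type I implicative derivation on $A$, then $d(x)=d(x)\Cup_1 x=d(x)\Cup_2 x$ for all $x\in A$. (2) If $d$ is a type II implicative derivation on $A$, then [$d(x)=x\Cup_1 d(x)=x\Cup_2 d(x)$ for all $x\in A$] if and only if $d(1)=1$.
   Context: A pseudo-BCI algebra is a structure $(A,\to,\rightsquigarrow,1)$ of type $(2,2,0)$ such that for all $x,y,z\in A$: $(x\to y)\rightsquigarrow[(y\to z)\rightsquigarrow(x\to z)]=1$; $(x\rightsquigarrow y)\to[(y\rightsquigarrow z)\to(x\rightsquigarrow z)]=1$; $1\to x=x$; $1\rightsquigarrow x=x$; and $x\to y=1$, $y\to x=1$ imply $x=y$. Put $x\Cup_1 y=(x\to y)\rightsquigarrow y$ and $x\Cup_2 y=(x\rightsquigarrow y)\to y$. A map $d:A\to A$ is a type I implicative derivation if $d(x\to y)=(x\to d(y))\Cup_2(d(x)\to y)$ and $d(x\rightsquigarrow y)=(x\rightsquigarrow d(y))\Cup_1(d(x)\rightsquigarrow y)$ for all $x,y$; it is a type II implicative derivation if $d(x\to y)=(d(x)\to y)\Cup_2(x\to d(y))$ and $d(x\rightsquigarrow y)=(d(x)\rightsquigarrow y)\Cup_1(x\rightsquigarrow d(y))$ for all $x,y$. -}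

module Defs where

open import Level using (Level; suc)
open import Relation.Binary.PropositionalEquality using (_≡_)
open import Data.Product using (_×_)

record PseudoBCI (a : Level) : Set (suc a) where
  infixr 5 _⇒_ _⇝_
  field
    Carrier : Set a
    _⇒_     : Carrier → Carrier → Carrier
    _⇝_     : Carrier → Carrier → Carrier
    𝟙       : Carrier
    ax1 : ∀ x y z → ((x ⇒ y) ⇝ ((y ⇒ z) ⇝ (x ⇒ z))) ≡ 𝟙
    ax2 : ∀ x y z → ((x ⇝ y) ⇒ ((y ⇝ z) ⇒ (x ⇝ z))) ≡ 𝟙
    ax3 : ∀ x → (𝟙 ⇒ x) ≡ x
    ax4 : ∀ x → (𝟙 ⇝ x) ≡ x
    ax5 : ∀ x y → (x ⇒ y) ≡ 𝟙 → (y ⇒ x) ≡ 𝟙 → x ≡ y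

  _⋓₁_ : Carrier → Carrier → Carrier
  x ⋓₁ y = (x ⇒ y) ⇝ y

  _⋓₂_ : Carrier → Carrier → Carrier
  x ⋓₂ y = (x ⇝ y) ⇒ y

  IsTypeI : (Carrier → Carrier) → Set a
  IsTypeI d = (∀ x y → d (x ⇒ y) ≡ ((x ⇒ d y) ⋓₂ (d x ⇒ y)))
            × (∀ x y → d (x ⇝ y) ≡ ((x ⇝ d y) ⋓₁ (d x ⇝ y)))

  IsTypeII : (Carrier → Carrier) → Set a
  IsTypeII d = (∀ x y → d (x ⇒ y) ≡ ((d x ⇒ y) ⋓₂ (x ⇒ d y)))
             × (∀ x y → d (x ⇝ y) ≡ ((d x ⇝ y) ⋓₁ (x ⇝ d y)))

-- With x ≤ y meaning x → y = 1, the axioms make ≤ a partial order in which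
-- x ≤ x ⋓₂ y, y → z ≤ (c → y) → (c → z), and → and ⇝ can be exchanged.
-- Instantiating the derivation laws at 1 → x and 1 ⇝ x gives
-- d x = d x ⋓₂ (d 1 → x) for type I; since x ⋓₂ y ≤ x ⋓₂ (c → y), this forces
-- d x ⋓₂ x ≤ d x, and dually for ⋓₁. For type II the same instantiation gives
-- d x = (d 1 ⇝ x) ⋓₁ d x, which is x ⋓₁ d x when d 1 = 1; conversely
-- d 1 = 1 ⋓₁ d 1 = d 1 ⇝ d 1 = 1.
module Submission where

open import Defs
open import Level using (Level)
open import Relation.Binary.PropositionalEquality
  using (_≡_; sym; trans; cong; cong₂; subst; module ≡-Reasoning)
open import Data.Product using (_×_; _,_; proj₁)
open import Function.Bundles using (_⇔_; mk⇔)

module PseudoBCIProperties {a : Level} (A : PseudoBCI a) where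
  open PseudoBCI A
  open ≡-Reasoning

  infix 4 _≤_

  _≤_ : Carrier → Carrier → Set a
  x ≤ y = x ⇒ y ≡ 𝟙

  ⇝-refl : ∀ x → x ⇝ x ≡ 𝟙
  ⇝-refl x = begin
    x ⇝ x                     ≡⟨ sym (ax4 (x ⇝ x)) ⟩
    𝟙 ⇝ (x ⇝ x)               ≡⟨ sym (cong₂ _⇝_ (ax3 𝟙) (cong₂ _⇝_ (ax3 x) (ax3 x))) ⟩
    (𝟙 ⇒ 𝟙) ⇝ ((𝟙 ⇒ x) ⇝ (𝟙 ⇒ x)) ≡⟨ ax1 𝟙 𝟙 x ⟩
    𝟙                         ∎

  ≤-⋓₂ : ∀ x y → x ≤ x ⋓₂ y
  ≤-⋓₂ x y = trans (sym (cong₂ _⇒_ (ax4 x) (cong ((x ⇝ y) ⇒_) (ax4 y)))) (ax2 𝟙 x y)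

  ⇝-⋓₁ : ∀ x y → x ⇝ (x ⋓₁ y) ≡ 𝟙
  ⇝-⋓₁ x y = trans (sym (cong₂ _⇝_ (ax3 x) (cong ((x ⇒ y) ⇝_) (ax3 y)))) (ax1 𝟙 x y)

  ⇝≡𝟙⇒≤ : ∀ {x y} → x ⇝ y ≡ 𝟙 → x ≤ y
  ⇝≡𝟙⇒≤ {x} {y} x⇝y≡𝟙 =
    trans (cong (x ⇒_) (sym (trans (cong (_⇒ y) x⇝y≡𝟙) (ax3 y)))) (≤-⋓₂ x y)

  ≤⇒⇝≡𝟙 : ∀ {x y} → x ≤ y → x ⇝ y ≡ 𝟙
  ≤⇒⇝≡𝟙 {x} {y} x≤y =
    trans (cong (x ⇝_) (sym (trans (cong (_⇝ y) x≤y) (ax4 y)))) (⇝-⋓₁ x y)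

  ≤-⋓₁ : ∀ x y → x ≤ x ⋓₁ y
  ≤-⋓₁ x y = ⇝≡𝟙⇒≤ (⇝-⋓₁ x y)

  ≤-trans : ∀ {x y z} → x ≤ y → y ≤ z → x ≤ z
  ≤-trans {x} {y} {z} x≤y y≤z =
    trans (sym (trans (cong₂ _⇝_ x≤y (cong (_⇝ (x ⇒ z)) y≤z)) (trans (ax4 _) (ax4 _))))
          (ax1 x y z)

  ⇝-antitoneˡ : ∀ {x y} z → x ≤ y → y ⇝ z ≤ x ⇝ z
  ⇝-antitoneˡ {x} {y} z x≤y =
    trans (sym (trans (cong (_⇒ ((y ⇝ z) ⇒ (x ⇝ z))) (≤⇒⇝≡𝟙 x≤y)) (ax3 _))) (ax2 x y z)

  ⇒-antitoneˡ : ∀ {x y} z → x ≤ y → y ⇒ z ≤ x ⇒ z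
  ⇒-antitoneˡ {x} {y} z x≤y =
    ⇝≡𝟙⇒≤ (trans (sym (trans (cong (_⇝ ((y ⇒ z) ⇝ (x ⇒ z))) x≤y) (ax4 _))) (ax1 x y z))

  ⇒-⇝-exchange : ∀ x y z → x ⇒ (y ⇝ z) ≡ y ⇝ (x ⇒ z)
  ⇒-⇝-exchange x y z = ax5 _ _
    (≤-trans (⇝≡𝟙⇒≤ (ax1 x (y ⇝ z) z)) (⇝-antitoneˡ (x ⇒ z) (≤-⋓₂ y z)))
    (≤-trans (ax2 y (x ⇒ z) z) (⇒-antitoneˡ (y ⇝ z) (≤-⋓₁ x z)))

  ⇒-prefixing : ∀ c y z → y ⇒ z ≤ (c ⇒ y) ⇒ (c ⇒ z)
  ⇒-prefixing c y z =
    ⇝≡𝟙⇒≤ (trans (sym (⇒-⇝-exchange (c ⇒ y) (y ⇒ z) (c ⇒ z))) (⇝≡𝟙⇒≤ (ax1 c y z)))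

  ⇝-prefixing : ∀ c y z → y ⇝ z ≤ (c ⇝ y) ⇝ (c ⇝ z)
  ⇝-prefixing c y z = trans (⇒-⇝-exchange (y ⇝ z) (c ⇝ y) (c ⇝ z)) (≤⇒⇝≡𝟙 (ax2 c y z))

  ⋓₂-≤-⋓₂-⇒ : ∀ c x y → x ⋓₂ y ≤ x ⋓₂ (c ⇒ y)
  ⋓₂-≤-⋓₂-⇒ c x y =
    subst (λ t → x ⋓₂ y ≤ t ⇒ (c ⇒ y)) (⇒-⇝-exchange c x y) (⇒-prefixing c (x ⇝ y) y)

  ⋓₁-≤-⋓₁-⇝ : ∀ c x y → x ⋓₁ y ≤ x ⋓₁ (c ⇝ y)
  ⋓₁-≤-⋓₁-⇝ c x y =
    subst (λ t → x ⋓₁ y ≤ t ⇝ (c ⇝ y)) (sym (⇒-⇝-exchange x c y)) (⇝-prefixing c (x ⇒ y) y)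

  ⋓₂-fixed : ∀ c {x y} → x ≡ x ⋓₂ (c ⇒ y) → x ≡ x ⋓₂ y
  ⋓₂-fixed c {x} {y} x≡ =
    ax5 _ _ (≤-⋓₂ x y) (subst (x ⋓₂ y ≤_) (sym x≡) (⋓₂-≤-⋓₂-⇒ c x y))

  ⋓₁-fixed : ∀ c {x y} → x ≡ x ⋓₁ (c ⇝ y) → x ≡ x ⋓₁ y
  ⋓₁-fixed c {x} {y} x≡ =
    ax5 _ _ (≤-⋓₁ x y) (subst (x ⋓₁ y ≤_) (sym x≡) (⋓₁-≤-⋓₁-⇝ c x y))

  𝟙⋓₁-fixed⇒≡𝟙 : ∀ {x} → x ≡ 𝟙 ⋓₁ x → x ≡ 𝟙
  𝟙⋓₁-fixed⇒≡𝟙 {x} x≡ = begin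
    x               ≡⟨ x≡ ⟩
    (𝟙 ⇒ x) ⇝ x     ≡⟨ cong (_⇝ x) (ax3 x) ⟩
    x ⇝ x           ≡⟨ ⇝-refl x ⟩
    𝟙               ∎

  module _ {d : Carrier → Carrier} where

    typeI-⋓₂ : IsTypeI d → ∀ x → d x ≡ d x ⋓₂ (d 𝟙 ⇒ x)
    typeI-⋓₂ (d-⇒ , _) x = begin
      d x                            ≡⟨ cong d (sym (ax3 x)) ⟩
      d (𝟙 ⇒ x)                      ≡⟨ d-⇒ 𝟙 x ⟩
      (𝟙 ⇒ d x) ⋓₂ (d 𝟙 ⇒ x)         ≡⟨ cong (_⋓₂ (d 𝟙 ⇒ x)) (ax3 (d x)) ⟩
      d x ⋓₂ (d 𝟙 ⇒ x)               ∎

    typeI-⋓₁ : IsTypeI d → ∀ x → d x ≡ d x ⋓₁ (d 𝟙 ⇝ x)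
    typeI-⋓₁ (_ , d-⇝) x = begin
      d x                            ≡⟨ cong d (sym (ax4 x)) ⟩
      d (𝟙 ⇝ x)                      ≡⟨ d-⇝ 𝟙 x ⟩
      (𝟙 ⇝ d x) ⋓₁ (d 𝟙 ⇝ x)         ≡⟨ cong (_⋓₁ (d 𝟙 ⇝ x)) (ax4 (d x)) ⟩
      d x ⋓₁ (d 𝟙 ⇝ x)               ∎

    typeII-⋓₂ : IsTypeII d → ∀ x → d x ≡ (d 𝟙 ⇒ x) ⋓₂ d x
    typeII-⋓₂ (d-⇒ , _) x = begin
      d x                            ≡⟨ cong d (sym (ax3 x)) ⟩
      d (𝟙 ⇒ x)                      ≡⟨ d-⇒ 𝟙 x ⟩
      (d 𝟙 ⇒ x) ⋓₂ (𝟙 ⇒ d x)         ≡⟨ cong ((d 𝟙 ⇒ x) ⋓₂_) (ax3 (d x)) ⟩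
      (d 𝟙 ⇒ x) ⋓₂ d x               ∎

    typeII-⋓₁ : IsTypeII d → ∀ x → d x ≡ (d 𝟙 ⇝ x) ⋓₁ d x
    typeII-⋓₁ (_ , d-⇝) x = begin
      d x                            ≡⟨ cong d (sym (ax4 x)) ⟩
      d (𝟙 ⇝ x)                      ≡⟨ d-⇝ 𝟙 x ⟩
      (d 𝟙 ⇝ x) ⋓₁ (𝟙 ⇝ d x)         ≡⟨ cong ((d 𝟙 ⇝ x) ⋓₁_) (ax4 (d x)) ⟩
      (d 𝟙 ⇝ x) ⋓₁ d x               ∎

    typeII-d𝟙≡𝟙⇒⋓-x : IsTypeII d → d 𝟙 ≡ 𝟙 → ∀ x → (d x ≡ x ⋓₁ d x) × (d x ≡ x ⋓₂ d x)
    typeII-d𝟙≡𝟙⇒⋓-x typeII d𝟙≡𝟙 x =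
        trans (typeII-⋓₁ typeII x) (cong (_⋓₁ d x) (trans (cong (_⇝ x) d𝟙≡𝟙) (ax4 x)))
      , trans (typeII-⋓₂ typeII x) (cong (_⋓₂ d x) (trans (cong (_⇒ x) d𝟙≡𝟙) (ax3 x)))

proposition3p5 : ∀ {a : Level} (A : PseudoBCI a) → let open PseudoBCI A in
    (∀ (d : Carrier → Carrier) → IsTypeI d → ∀ x → (d x ≡ (d x ⋓₁ x)) × (d x ≡ (d x ⋓₂ x)))
    × (∀ (d : Carrier → Carrier) → IsTypeII d →
        ((∀ x → (d x ≡ (x ⋓₁ d x)) × (d x ≡ (x ⋓₂ d x))) ⇔ (d 𝟙 ≡ 𝟙)))
proposition3p5 A = typeI , typeII
  where
    open PseudoBCI A
    open PseudoBCIProperties A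

    typeI : ∀ d → IsTypeI d → ∀ x → (d x ≡ d x ⋓₁ x) × (d x ≡ d x ⋓₂ x)
    typeI d typeI-d x = ⋓₁-fixed (d 𝟙) (typeI-⋓₁ typeI-d x) , ⋓₂-fixed (d 𝟙) (typeI-⋓₂ typeI-d x)

    typeII : ∀ d → IsTypeII d → (∀ x → (d x ≡ x ⋓₁ d x) × (d x ≡ x ⋓₂ d x)) ⇔ (d 𝟙 ≡ 𝟙)
    typeII d typeII-d =
      mk⇔ (λ joins → 𝟙⋓₁-fixed⇒≡𝟙 (proj₁ (joins 𝟙))) (typeII-d𝟙≡𝟙⇒⋓-x typeII-d)
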